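{- Let $A$, $B$, $C$ be $m \times n$ matrices over $\{ -1,0,1\}$ such that $A$ has an entry $0$ and ${\rm IST}(A,B,C)=\infty$. Then: (1) if $A$ and $B$ are not layered matrices, then every entry of $C$ is $-1$; (2) if $A$ and $C$ are not layered matrices, then every entry of $B$ is $1$.
   Context: For an $m\times n$ matrix $M=[m_{ij}]$ over $\{ -1,0,1\}$, $G_o(M)$ is the directed graph on $\{1,\dots,n+m\}$ with edges $j\to i$ for all $1\le j<i\le n$, and for $1\le p\le m$, $1\le j\le n$: an edge $j\to n+p$ if $m_{pj}=1$, an edge $n+p\to j$ if $m_{pj}=-1$, no edge if $m_{pj}=0$; no edges among $n+1,\dots,n+m$. A directed graph is semi-transitive if it is acyclic and for every directed path $u_1\to\cdots\to u_t$, $t\ge2$, either there is no edge $u_1\to u_t$ or all edges $u_i\to u_j$ ($1\le i<j\le t$) exist. For $m\times n$ matrices $A,B,C$ over $\{ -1,0,1\}$, the morphism $\varphi$ replaces each entry $0,1,-1$ by the block $A,B,C$ respectively; $M^k(A,B,C)=\varphi^k([0])$ and $G_o^k(A,B,C)=G_o(M^k(A,B,C))$. If $A$ has an entry $0$, ${\rm IST}(A,B,C)$ is the least $\ell\ge0$ with $G_o^\ell(A,B,C)$ not semi-transitive, or $\infty$ if none exists. A matrix is layered if all entries in each row are identical. -}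

module Defs where

open import Data.Nat using (ℕ; zero; suc; _*_)
open import Data.Fin using (Fin; zero; suc; remQuot; inject₁; fromℕ; _<_)
open import Data.Sum using (_⊎_; inj₁; inj₂)
open import Data.Product using (_×_; Σ; ∃; proj₁; proj₂; _,_)
open import Data.Empty using (⊥)
open import Relation.Binary.PropositionalEquality using (_≡_)
open import Relation.Nullary using (¬_)

-- Entries of matrices over {-1,0,1}: zer = 0, one = 1, neg = -1.
data Tri : Set where
  zer one neg : Tri

Matrix : ℕ → ℕ → Set
Matrix r c = Fin r → Fin c → Tri

-- G_o(M) for an r × c matrix M.  Vertices: inj₁ j (column j, i.e. vertex j ∈ {1..c})
-- and inj₂ p (row p, i.e. vertex c+p).
Vertex : ℕ → ℕ → Set
Vertex r c = Fin c ⊎ Fin r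

Edge : ∀ {r c} → Matrix r c → Vertex r c → Vertex r c → Set
Edge M (inj₁ j) (inj₁ i) = j < i
Edge M (inj₁ j) (inj₂ p) = M p j ≡ one
Edge M (inj₂ p) (inj₁ j) = M p j ≡ neg
Edge M (inj₂ p) (inj₂ q) = ⊥

IsPath : ∀ {V : Set} → (V → V → Set) → (s : ℕ) → (Fin (suc s) → V) → Set
IsPath E s u = ∀ (i : Fin s) → E (u (inject₁ i)) (u (suc i))

Acyclic : ∀ {V : Set} → (V → V → Set) → Set
Acyclic {V} E = ∀ (s : ℕ) (u : Fin (suc s) → V) → IsPath E s u → ¬ E (u (fromℕ s)) (u zero)

SemiTransitive : ∀ {V : Set} → (V → V → Set) → Set
SemiTransitive {V} E =
  Acyclic E ×
  (∀ (s : ℕ) (u : Fin (suc (suc s)) → V) → IsPath E (suc s) u →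
     E (u zero) (u (fromℕ (suc s))) → ∀ (i j : Fin (suc (suc s))) → i < j → E (u i) (u j))

block : ∀ {m n} → Matrix m n → Matrix m n → Matrix m n → Tri → Matrix m n
block A B C zer = A
block A B C one = B
block A B C neg = C

φ : ∀ {m n r c} → Matrix m n → Matrix m n → Matrix m n → Matrix r c → Matrix (r * m) (c * n)
φ {m} {n} A B C M i j =
  let pa = remQuot m i
      qb = remQuot n j
  in block A B C (M (proj₁ pa) (proj₁ qb)) (proj₂ pa) (proj₂ qb)

-- Sizes of M^k: rows m^k, columns n^k (defined by the recursion matching φ).
pw : ℕ → ℕ → ℕ
pw m zero = 1
pw m (suc k) = pw m k * m

zero1 : Matrix 1 1
zero1 _ _ = zer

Mk : ∀ {m n} → Matrix m n → Matrix m n → Matrix m n → (k : ℕ) → Matrix (pw m k) (pw n k)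
Mk A B C zero = zero1
Mk A B C (suc k) = φ A B C (Mk A B C k)

GoSemiTransitive : ∀ {m n} → Matrix m n → Matrix m n → Matrix m n → ℕ → Set
GoSemiTransitive A B C k = SemiTransitive (Edge (Mk A B C k))

HasZero : ∀ {m n} → Matrix m n → Set
HasZero A = ∃ λ p → ∃ λ j → A p j ≡ zer

IST∞ : ∀ {m n} → Matrix m n → Matrix m n → Matrix m n → Set
IST∞ A B C = ∀ (ℓ : ℕ) → GoSemiTransitive A B C ℓ

Layered : ∀ {m n} → Matrix m n → Set
Layered M = ∀ p j j' → M p j ≡ M p j'

-- Semi-transitivity of G_o(M) forbids a row of M from reading x y x y (x ≢ y) along
-- increasing columns: it would force 1 0 1 or -1 0 -1 (excluded by shortcuts), or -1 before
-- 1 (a cycle).  If some row of M^k has the letter x at columns j < j', the corresponding row of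
-- M^(k+1) contains the block of x twice side by side, so that block must be layered.  As A is
-- not layered, M^2 has rows of length n^2 ≥ 4, so by pigeonhole some letter x repeats in a
-- row; x ≠ 0 and x ≠ 1 since A and B are not layered, so x = -1.  Two copies of C then sit
-- side by side in M^3, so every entry C_st repeats in a row of M^3, whence its block is
-- layered and C_st = -1.  Part (2) is symmetric.
module Submission where

open import Defs
open import Data.Nat as ℕ using (ℕ; zero; suc; z≤n; s≤s)
open import Data.Nat.Properties using (*-identityˡ; *-mono-≤; +-monoʳ-<)
open import Data.Fin using (Fin; zero; suc; combine; toℕ; _<_)
open import Data.Fin.Properties using (remQuot-combine; toℕ-combine; combine-monoˡ-<; <-cmp; pigeonhole)
open import Data.Vec using ([]; _∷_; lookup)
open import Data.Product using (Σ; ∃; _×_; _,_; proj₁; proj₂)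
open import Data.Sum using (inj₁; inj₂)
open import Data.Empty using (⊥-elim)
open import Relation.Binary using (tri<; tri≈; tri>)
open import Relation.Binary.PropositionalEquality using (_≡_; refl; sym; trans; cong; cong₂; subst)
open import Relation.Nullary using (¬_)

Tri→Fin3 : Tri → Fin 3
Tri→Fin3 zer = zero
Tri→Fin3 one = suc zero
Tri→Fin3 neg = suc (suc zero)

Tri→Fin3-injective : ∀ {x y} → Tri→Fin3 x ≡ Tri→Fin3 y → x ≡ y
Tri→Fin3-injective {zer} {zer} _ = refl
Tri→Fin3-injective {one} {one} _ = refl
Tri→Fin3-injective {neg} {neg} _ = refl
Tri→Fin3-injective {zer} {one} ()
Tri→Fin3-injective {zer} {neg} ()
Tri→Fin3-injective {one} {zer} ()
Tri→Fin3-injective {one} {neg} ()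
Tri→Fin3-injective {neg} {zer} ()
Tri→Fin3-injective {neg} {one} ()

Repeats : ∀ {r c} → Matrix r c → Tri → Set
Repeats {r} {c} M x =
  Σ (Fin r) λ p → Σ (Fin c) λ j → Σ (Fin c) λ j' → j < j' × M p j ≡ x × M p j' ≡ x

repeats-in-long-row : ∀ {r c} (M : Matrix r c) → Fin r → 3 ℕ.< c → ∃ (Repeats M)
repeats-in-long-row M p 3<c with j , j' , j<j' , eq ← pigeonhole 3<c (λ j → Tri→Fin3 (M p j)) =
  M p j , p , j , j' , j<j' , refl , sym (Tri→Fin3-injective eq)

¬Layered⇒shape : ∀ {r c} (M : Matrix r c) → ¬ Layered M → Fin r × 2 ℕ.≤ c
¬Layered⇒shape {zero}  M ¬lay = ⊥-elim (¬lay λ ())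
¬Layered⇒shape {suc r} {zero}        M ¬lay = ⊥-elim (¬lay λ _ ())
¬Layered⇒shape {suc r} {suc zero}    M ¬lay = ⊥-elim (¬lay λ { _ zero zero → refl })
¬Layered⇒shape {suc r} {suc (suc c)} M ¬lay = zero , s≤s (s≤s z≤n)

module SemiTransitiveRows {r c} (M : Matrix r c) (st : SemiTransitive (Edge M)) where

  ones-convex : ∀ p {c₁ c₂ c₃} → c₁ < c₂ → c₂ < c₃ → M p c₁ ≡ one → M p c₃ ≡ one → M p c₂ ≡ one
  ones-convex p {c₁} {c₂} {c₃} c₁<c₂ c₂<c₃ e₁ e₃ =
    proj₂ st 2 (lookup (inj₁ c₁ ∷ inj₁ c₂ ∷ inj₁ c₃ ∷ inj₂ p ∷ []))
      (λ { zero → c₁<c₂ ; (suc zero) → c₂<c₃ ; (suc (suc zero)) → e₃ })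
      e₁ (suc zero) (suc (suc (suc zero))) (s≤s (s≤s z≤n))

  negs-convex : ∀ p {c₁ c₂ c₃} → c₁ < c₂ → c₂ < c₃ → M p c₁ ≡ neg → M p c₃ ≡ neg → M p c₂ ≡ neg
  negs-convex p {c₁} {c₂} {c₃} c₁<c₂ c₂<c₃ e₁ e₃ =
    proj₂ st 2 (lookup (inj₂ p ∷ inj₁ c₁ ∷ inj₁ c₂ ∷ inj₁ c₃ ∷ []))
      (λ { zero → e₁ ; (suc zero) → c₁<c₂ ; (suc (suc zero)) → c₂<c₃ })
      e₃ zero (suc (suc zero)) (s≤s z≤n)

  ¬neg-before-one : ∀ p {c₁ c₂} → c₁ < c₂ → M p c₁ ≡ neg → ¬ M p c₂ ≡ one
  ¬neg-before-one p {c₁} {c₂} c₁<c₂ e₁ =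
    proj₁ st 2 (lookup (inj₂ p ∷ inj₁ c₁ ∷ inj₁ c₂ ∷ []))
      (λ { zero → e₁ ; (suc zero) → c₁<c₂ })

  alternating⇒≡ : ∀ p {c₁ c₂ c₃ c₄ x y} → c₁ < c₂ → c₂ < c₃ → c₃ < c₄ →
                  M p c₁ ≡ x → M p c₂ ≡ y → M p c₃ ≡ x → M p c₄ ≡ y → x ≡ y
  alternating⇒≡ p {x = zer} {zer} _ _ _ _ _ _ _ = refl
  alternating⇒≡ p {x = one} {one} _ _ _ _ _ _ _ = refl
  alternating⇒≡ p {x = neg} {neg} _ _ _ _ _ _ _ = refl
  alternating⇒≡ p {x = zer} {one} _ l₂₃ l₃₄ _ e₂ e₃ e₄ with () ← trans (sym e₃) (ones-convex p l₂₃ l₃₄ e₂ e₄)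
  alternating⇒≡ p {x = zer} {neg} _ l₂₃ l₃₄ _ e₂ e₃ e₄ with () ← trans (sym e₃) (negs-convex p l₂₃ l₃₄ e₂ e₄)
  alternating⇒≡ p {x = one} {zer} l₁₂ l₂₃ _ e₁ e₂ e₃ _ with () ← trans (sym e₂) (ones-convex p l₁₂ l₂₃ e₁ e₃)
  alternating⇒≡ p {x = neg} {zer} l₁₂ l₂₃ _ e₁ e₂ e₃ _ with () ← trans (sym e₂) (negs-convex p l₁₂ l₂₃ e₁ e₃)
  alternating⇒≡ p {x = one} {neg} _ l₂₃ _ _ e₂ e₃ _ = ⊥-elim (¬neg-before-one p l₂₃ e₂ e₃)
  alternating⇒≡ p {x = neg} {one} l₁₂ _ _ e₁ e₂ _ _ = ⊥-elim (¬neg-before-one p l₁₂ e₁ e₂)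

<-equal⇒constant : ∀ {a} {A : Set a} {k} {f : Fin k → A} →
                   (∀ {t t'} → t < t' → f t ≡ f t') → ∀ t t' → f t ≡ f t'
<-equal⇒constant {f = f} eq t t' with <-cmp t t'
... | tri< t<t' _ _ = eq t<t'
... | tri≈ _ t≡t' _ = cong f t≡t'
... | tri> _ _ t'<t = sym (eq t'<t)

combine-monoʳ-< : ∀ {a b} (i : Fin a) {k l : Fin b} → k < l → combine i k < combine i l
combine-monoʳ-< {b = b} i {k} {l} k<l
  rewrite toℕ-combine i k | toℕ-combine i l = +-monoʳ-< (b ℕ.* toℕ i) k<l

module Substitution {m n} (A B C : Matrix m n) where

  φ-combine : ∀ {r c} (M : Matrix r c) {i j x} → M i j ≡ x → ∀ s t →
              φ A B C M (combine i s) (combine j t) ≡ block A B C x s t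
  φ-combine {r} {c} M {i} {j} refl s t =
    cong₂ (λ (ps : Fin r × Fin m) (qt : Fin c × Fin n) →
             block A B C (M (proj₁ ps) (proj₁ qt)) (proj₂ ps) (proj₂ qt))
          (remQuot-combine i s) (remQuot-combine j t)

  repeats-φ : ∀ {r c} {M : Matrix r c} {x} → Repeats M x → ∀ s t → Repeats (φ A B C M) (block A B C x s t)
  repeats-φ {M = M} (p , j , j' , j<j' , e , e') s t =
    combine p s , combine j t , combine j' t , combine-monoˡ-< t t j<j' ,
    φ-combine M e s t , φ-combine M e' s t

  repeats⇒block-layered : ∀ {r c} (M : Matrix r c) {x} → SemiTransitive (Edge (φ A B C M)) →
                          Repeats M x → Layered (block A B C x)
  repeats⇒block-layered M st (p , j , j' , j<j' , e , e') s = <-equal⇒constant λ {t} {t'} t<t' →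
    alternating⇒≡ (combine p s)
      (combine-monoʳ-< j t<t') (combine-monoˡ-< t' t j<j') (combine-monoʳ-< j' t<t')
      (φ-combine M e s t) (φ-combine M e s t') (φ-combine M e' s t) (φ-combine M e' s t')
    where open SemiTransitiveRows (φ A B C M) st

  repeats-in-M² : ¬ Layered A → ∃ (Repeats (Mk A B C 2))
  repeats-in-M² ¬lay with p , 2≤n ← ¬Layered⇒shape A ¬lay =
    repeats-in-long-row (Mk A B C 2) (combine (combine (zero {n = 0}) p) p)
      (subst (3 ℕ.<_) (cong (ℕ._* n) (sym (*-identityˡ n))) (*-mono-≤ 2≤n 2≤n))

module _ {m n} {A B C : Matrix m n} (ist : IST∞ A B C) where
  open Substitution A B C

  repeats-in-Mk⇒block-layered : ∀ k {x} → Repeats (Mk A B C k) x → Layered (block A B C x)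
  repeats-in-Mk⇒block-layered k = repeats⇒block-layered (Mk A B C k) (ist (suc k))

  forced-entries : (t : Tri) → (∀ x → Layered (block A B C x) → x ≡ t) → ¬ Layered A →
                   ∀ s u → block A B C t s u ≡ t
  forced-entries t only-t ¬lay s u =
    only-t _ (repeats-in-Mk⇒block-layered 3 (repeats-φ t-repeats s u))
    where
      t-repeats : Repeats (Mk A B C 2) t
      t-repeats with repeats-in-M² ¬lay
      ... | x , rep with only-t x (repeats-in-Mk⇒block-layered 2 rep)
      ...   | refl = rep

layered-block⇒neg : ∀ {m n} {A B C : Matrix m n} → ¬ Layered A → ¬ Layered B →
                    ∀ x → Layered (block A B C x) → x ≡ neg
layered-block⇒neg ¬layA _ zer layA = ⊥-elim (¬layA layA)
layered-block⇒neg _ ¬layB one layB = ⊥-elim (¬layB layB)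
layered-block⇒neg _ _     neg _    = refl

layered-block⇒one : ∀ {m n} {A B C : Matrix m n} → ¬ Layered A → ¬ Layered C →
                    ∀ x → Layered (block A B C x) → x ≡ one
layered-block⇒one ¬layA _ zer layA = ⊥-elim (¬layA layA)
layered-block⇒one _ _     one _    = refl
layered-block⇒one _ ¬layC neg layC = ⊥-elim (¬layC layC)

-- HasZero A only makes IST(A,B,C) well defined; the argument does not need it.
lemma3p8 : ∀ {m n : ℕ} (A B C : Matrix m n) → HasZero A → IST∞ A B C →
    ((¬ Layered A → ¬ Layered B → ∀ p j → C p j ≡ neg) ×
     (¬ Layered A → ¬ Layered C → ∀ p j → B p j ≡ one))
lemma3p8 A B C _ ist =
  (λ ¬layA ¬layB → forced-entries ist neg (layered-block⇒neg ¬layA ¬layB) ¬layA) ,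
  (λ ¬layA ¬layC → forced-entries ist one (layered-block⇒one ¬layA ¬layC) ¬layA)
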